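{- Let $\mathsf{C}$ be a $*$-autonomous category with dualizing object $0$, let $Q:\mathsf{C}\to\mathsf{SLatt}$ be a monoidal functor, and suppose that $(0,\omega)$ is a dualizing object of $\int Q$ for some $\omega\in Q(0)$. Let $R:=P\circ UQ:\mathsf{C}\to\mathsf{SLatt}$ with its induced monoidal structure, and let $\perp\!\!\!\perp:=\{x\in Q(0)\mid x\le\omega\}\in R(0)$. Then the maps $Q(X)\to R^{\jmath}(X)$, $x\mapsto{\downarrow}x:=\{x'\in Q(X)\mid x'\le x\}$, form a natural isomorphism between the functors $Q$ and $R^{\jmath}:\mathsf{C}\to\mathsf{SLatt}$, where $R^\jmath$ is the double-negation construction for $R$ with respect to $\perp\!\!\!\perp$.
   Context: $(\mathsf{C},\otimes,I,a,\lambda,\rho,\sigma)$ is symmetric monoidal closed with internal hom $\multimap$, counit $\mathrm{ev}_{X,Y}:X\otimes(X\multimap Y)\to Y$, and $0$ dualizing ($X^*:=X\multimap0$, canonical arrows $j_X:X\to X^{**}$ invertible). A monoidal functor $R:\mathsf{C}\to\mathsf{SLatt}$ comes with $u_R\in R(I)$ and maps $\mu^R_{X,Y}:R(X)\times R(Y)\to R(X\otimes Y)$, sup-preserving in each variable, natural, and satisfying the coherence equalities $R(\lambda_Y)(\mu^R_{I,Y}(u_R,y))=y$, $R(\rho_X)(\mu^R_{X,I}(x,u_R))=x$, $R(a)(\mu^R(\mu^R(x,y),z))=\mu^R(x,\mu^R(y,z))$, $R(\sigma_{X,Y})(\mu^R_{X,Y}(x,y))=\mu^R_{Y,X}(y,x)$.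 For such $R$ and $w\in R(0)$: $\langle x,b\rangle^R_{X,Y}:=R(\mathrm{ev}_{X,Y})(\mu^R_{X,X\multimap Y}(x,b))$, $\iota^R_{X,Y}(\alpha,-)$ its right adjoint, $w_X(\alpha):=\iota^R_{X,0}(\alpha,w)$, $\beta^\perp:=\bigvee\{\alpha\in R(X)\mid\langle\alpha,\beta\rangle^R_{X,0}\le w\}$ for $\beta\in R(X^*)$, $\jmath_X(\alpha):=(w_X(\alpha))^\perp$, $R^\jmath(X):=\{\alpha\in R(X)\mid\jmath_X(\alpha)=\alpha\}$, $R^\jmath(f):=\jmath_Y\circ R(f)$. The total category $\int Q$ has objects $(X,x)$, $x\in Q(X)$, arrows $f:(X,x)\to(Y,y)$ with $Q(f)(x)\le y$, and is symmetric monoidal closed with $(X,\alpha)\multimap(Y,\beta)=(X\multimap Y,\iota_{X,Y}(\alpha,\beta))$; $(0,\omega)$ is dualizing in $\int Q$ if each $j_X:(X,\alpha)\to(X^{**},\omega_{X^*}(\omega_X(\alpha)))$ is invertible in $\int Q$. $U:\mathsf{SLatt}\to\mathsf{Set}$ is the forgetful functor and $P:\mathsf{Set}\to\mathsf{SLatt}$ the covariant powerset functor ($P(f)(A)=f[A]$). The monoidal structure of $R=P\circ UQ$ is $u_R:=\{u\}$ and $\mu^R_{X,Y}(A,B):=\{\mu_{X,Y}(a,b)\mid a\in A,b\in B\}$. -}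

module Defs where

open import Level using (Level; _⊔_) renaming (suc to lsuc)
open import Data.Product using (Σ; ∃; _×_; _,_)
open import Relation.Binary.PropositionalEquality using (_≡_)
open import Relation.Unary using (Pred; _⊆_; _≐_)

record SMCCat (o h : Level) : Set (lsuc (o ⊔ h)) where
  infixr 9 _∘_
  infixr 10 _⊗₀_ _⊗₁_
  infixr 8 _⊸_
  field
    Obj : Set o
    Hom : Obj → Obj → Set h
    id  : ∀ {A} → Hom A A
    _∘_ : ∀ {A B C} → Hom B C → Hom A B → Hom A C
    identityˡ : ∀ {A B} (f : Hom A B) → id ∘ f ≡ f
    identityʳ : ∀ {A B} (f : Hom A B) → f ∘ id ≡ f
    assoc : ∀ {A B C D} (h : Hom C D) (g : Hom B C) (f : Hom A B) →
            (h ∘ g) ∘ f ≡ h ∘ (g ∘ f)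
    _⊗₀_ : Obj → Obj → Obj
    _⊗₁_ : ∀ {A B C D} → Hom A B → Hom C D → Hom (A ⊗₀ C) (B ⊗₀ D)
    ⊗-id : ∀ {A C} → id {A} ⊗₁ id {C} ≡ id
    ⊗-∘  : ∀ {A B E C D F} (f : Hom B E) (g : Hom A B) (k : Hom D F) (l : Hom C D) →
           (f ∘ g) ⊗₁ (k ∘ l) ≡ (f ⊗₁ k) ∘ (g ⊗₁ l)
    I : Obj
    a⇒ : ∀ {A B C} → Hom ((A ⊗₀ B) ⊗₀ C) (A ⊗₀ (B ⊗₀ C))
    a⇐ : ∀ {A B C} → Hom (A ⊗₀ (B ⊗₀ C)) ((A ⊗₀ B) ⊗₀ C)
    a-isoˡ : ∀ {A B C} → a⇐ {A} {B} {C} ∘ a⇒ ≡ id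
    a-isoʳ : ∀ {A B C} → a⇒ {A} {B} {C} ∘ a⇐ ≡ id
    a-nat : ∀ {A A′ B B′ C C′} (f : Hom A A′) (g : Hom B B′) (k : Hom C C′) →
            a⇒ ∘ ((f ⊗₁ g) ⊗₁ k) ≡ (f ⊗₁ (g ⊗₁ k)) ∘ a⇒
    l⇒ : ∀ {A} → Hom (I ⊗₀ A) A
    l⇐ : ∀ {A} → Hom A (I ⊗₀ A)
    l-isoˡ : ∀ {A} → l⇐ {A} ∘ l⇒ ≡ id
    l-isoʳ : ∀ {A} → l⇒ {A} ∘ l⇐ ≡ id
    l-nat : ∀ {A B} (f : Hom A B) → l⇒ ∘ (id ⊗₁ f) ≡ f ∘ l⇒
    r⇒ : ∀ {A} → Hom (A ⊗₀ I) A
    r⇐ : ∀ {A} → Hom A (A ⊗₀ I)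
    r-isoˡ : ∀ {A} → r⇐ {A} ∘ r⇒ ≡ id
    r-isoʳ : ∀ {A} → r⇒ {A} ∘ r⇐ ≡ id
    r-nat : ∀ {A B} (f : Hom A B) → r⇒ ∘ (f ⊗₁ id) ≡ f ∘ r⇒
    σ : ∀ {A B} → Hom (A ⊗₀ B) (B ⊗₀ A)
    σ-inv : ∀ {A B} → σ {B} {A} ∘ σ {A} {B} ≡ id
    σ-nat : ∀ {A A′ B B′} (f : Hom A A′) (g : Hom B B′) →
            σ ∘ (f ⊗₁ g) ≡ (g ⊗₁ f) ∘ σ
    triangle : ∀ {A B} → (id {A} ⊗₁ l⇒ {B}) ∘ a⇒ ≡ r⇒ ⊗₁ id
    pentagon : ∀ {A B C D} →
               (id {A} ⊗₁ a⇒ {B} {C} {D}) ∘ a⇒ ∘ (a⇒ ⊗₁ id) ≡ a⇒ ∘ a⇒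
    hexagon  : ∀ {A B C} →
               a⇒ {B} {C} {A} ∘ σ ∘ a⇒ ≡ (id ⊗₁ σ) ∘ a⇒ ∘ (σ ⊗₁ id)
    _⊸_ : Obj → Obj → Obj
    ev  : ∀ {X Y} → Hom (X ⊗₀ (X ⊸ Y)) Y
    Λ   : ∀ {X Y Z} → Hom (X ⊗₀ Z) Y → Hom Z (X ⊸ Y)
    Λ-β : ∀ {X Y Z} (f : Hom (X ⊗₀ Z) Y) → ev ∘ (id ⊗₁ Λ f) ≡ f
    Λ-unique : ∀ {X Y Z} (f : Hom (X ⊗₀ Z) Y) (g : Hom Z (X ⊸ Y)) →
               ev ∘ (id ⊗₁ g) ≡ f → g ≡ Λ f

module _ {o h} (C : SMCCat o h) where
  open SMCCat C
  canonJ : (Z X : Obj) → Hom X ((X ⊸ Z) ⊸ Z)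
  canonJ Z X = Λ (ev {X} {Z} ∘ σ {X ⊸ Z} {X})

record StarAutonomous (o h : Level) : Set (lsuc (o ⊔ h)) where
  field
    smc : SMCCat o h
  open SMCCat smc
  field
    𝟘 : Obj
    jinv  : ∀ X → Hom ((X ⊸ 𝟘) ⊸ 𝟘) X
    jinvˡ : ∀ X → jinv X ∘ canonJ smc 𝟘 X ≡ id
    jinvʳ : ∀ X → canonJ smc 𝟘 X ∘ jinv X ≡ id

record SLatt (c : Level) : Set (lsuc c) where
  infix 4 _≤_
  field
    Carrier : Set c
    _≤_ : Carrier → Carrier → Set c
    ≤-refl : ∀ {x} → x ≤ x
    ≤-trans : ∀ {x y z} → x ≤ y → y ≤ z → x ≤ z
    ≤-antisym : ∀ {x y} → x ≤ y → y ≤ x → x ≡ y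
    ⋁ : Pred Carrier c → Carrier
    ⋁-upper : ∀ (S : Pred Carrier c) {x} → S x → x ≤ ⋁ S
    ⋁-least : ∀ (S : Pred Carrier c) {y} → (∀ {x} → S x → x ≤ y) → ⋁ S ≤ y

image : ∀ {a b ℓ} {A : Set a} {B : Set b} → (A → B) → Pred A ℓ → Pred B (a ⊔ b ⊔ ℓ)
image {A = A} f S y = Σ A λ x → S x × f x ≡ y

SupPreserving : ∀ {c} (L M : SLatt c) → (SLatt.Carrier L → SLatt.Carrier M) → Set (lsuc c)
SupPreserving L M f = ∀ (S : Pred (SLatt.Carrier L) _) → f (SLatt.⋁ L S) ≡ SLatt.⋁ M (image f S)

record MonoidalFunctor {o h} (C : SMCCat o h) (c : Level) : Set (o ⊔ h ⊔ lsuc c) where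
  open SMCCat C
  field
    F₀ : Obj → SLatt c
  ∣_∣ : Obj → Set c
  ∣ X ∣ = SLatt.Carrier (F₀ X)
  field
    F₁ : ∀ {X Y} → Hom X Y → ∣ X ∣ → ∣ Y ∣
    F₁-sup : ∀ {X Y} (f : Hom X Y) → SupPreserving (F₀ X) (F₀ Y) (F₁ f)
    F-id : ∀ {X} (x : ∣ X ∣) → F₁ id x ≡ x
    F-∘  : ∀ {X Y Z} (g : Hom Y Z) (f : Hom X Y) (x : ∣ X ∣) → F₁ (g ∘ f) x ≡ F₁ g (F₁ f x)
    u : ∣ I ∣
    μ : ∀ {X Y} → ∣ X ∣ → ∣ Y ∣ → ∣ X ⊗₀ Y ∣
    μ-supˡ : ∀ {X Y} (y : ∣ Y ∣) → SupPreserving (F₀ X) (F₀ (X ⊗₀ Y)) (λ x → μ x y)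
    μ-supʳ : ∀ {X Y} (x : ∣ X ∣) → SupPreserving (F₀ Y) (F₀ (X ⊗₀ Y)) (λ y → μ x y)
    μ-nat : ∀ {X X′ Y Y′} (f : Hom X X′) (g : Hom Y Y′) (x : ∣ X ∣) (y : ∣ Y ∣) →
            F₁ (f ⊗₁ g) (μ x y) ≡ μ (F₁ f x) (F₁ g y)
    unitˡ : ∀ {Y} (y : ∣ Y ∣) → F₁ l⇒ (μ u y) ≡ y
    unitʳ : ∀ {X} (x : ∣ X ∣) → F₁ r⇒ (μ x u) ≡ x
    μ-assoc : ∀ {X Y Z} (x : ∣ X ∣) (y : ∣ Y ∣) (z : ∣ Z ∣) →
              F₁ a⇒ (μ (μ x y) z) ≡ μ x (μ y z)
    μ-sym : ∀ {X Y} (x : ∣ X ∣) (y : ∣ Y ∣) → F₁ σ (μ x y) ≡ μ y x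

module Constructions {o h c} (C : StarAutonomous o h)
                     (Q : MonoidalFunctor (StarAutonomous.smc C) c) where
  open StarAutonomous C
  open SMCCat smc
  open MonoidalFunctor Q

  _⊑_ : ∀ {X} → ∣ X ∣ → ∣ X ∣ → Set c
  _⊑_ {X} = SLatt._≤_ (F₀ X)

  -- pairing ⟨x,b⟩^Q_{X,Y} and its right adjoint ι^Q_{X,Y}
  pairQ : ∀ {X Y} → ∣ X ∣ → ∣ X ⊸ Y ∣ → ∣ Y ∣
  pairQ {X} {Y} x b = F₁ (ev {X} {Y}) (μ x b)

  ιQ : ∀ {X Y} → ∣ X ∣ → ∣ Y ∣ → ∣ X ⊸ Y ∣
  ιQ {X} {Y} x y = SLatt.⋁ (F₀ (X ⊸ Y)) (λ b → pairQ {X} {Y} x b ⊑ y)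

  negQ : ∣ 𝟘 ∣ → ∀ X → ∣ X ∣ → ∣ X ⊸ 𝟘 ∣
  negQ ω X α = ιQ {X} {𝟘} α ω

  -- (0,ω) is dualizing in ∫Q: every j_X : (X,α) → (X**, ω_{X*}(ω_X(α)))
  -- is invertible in ∫Q (its inverse necessarily being jinv X).
  IsDualizing∫ : ∣ 𝟘 ∣ → Set (o ⊔ c)
  IsDualizing∫ ω = ∀ X (α : ∣ X ∣) →
      (F₁ (canonJ smc 𝟘 X) α ⊑ negQ ω (X ⊸ 𝟘) (negQ ω X α))
    × (F₁ (jinv X) (negQ ω (X ⊸ 𝟘) (negQ ω X α)) ⊑ α)

  -- R := P ∘ U Q : R(X) = subsets of Q(X) (predicates at level c),
  -- R(f) = direct image, u_R = {u}, μ^R(A,B) = {μ(a,b)}.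
  R₁ : ∀ {X Y} {ℓ} → Hom X Y → Pred ∣ X ∣ ℓ → Pred ∣ Y ∣ (c ⊔ ℓ)
  R₁ f A = image (F₁ f) A

  μR : ∀ {X Y} {ℓ₁ ℓ₂} → Pred ∣ X ∣ ℓ₁ → Pred ∣ Y ∣ ℓ₂ → Pred ∣ X ⊗₀ Y ∣ (c ⊔ ℓ₁ ⊔ ℓ₂)
  μR {X} {Y} A B z = Σ ∣ X ∣ λ a → Σ ∣ Y ∣ λ b → A a × B b × μ a b ≡ z

  pairR : ∀ {X Y} {ℓ₁ ℓ₂} → Pred ∣ X ∣ ℓ₁ → Pred ∣ X ⊸ Y ∣ ℓ₂ → Pred ∣ Y ∣ (c ⊔ ℓ₁ ⊔ ℓ₂)
  pairR {X} {Y} A B = R₁ (ev {X} {Y}) (μR A B)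

  -- ι^R_{X,Y}(A,-) : right adjoint of ⟨A,-⟩^R, i.e. the union of all
  -- B ∈ R(X ⊸ Y) with ⟨A,B⟩ ⊆ C.
  ιR : ∀ {X Y} {ℓ₁ ℓ₂} → Pred ∣ X ∣ ℓ₁ → Pred ∣ Y ∣ ℓ₂ → Pred ∣ X ⊸ Y ∣ (lsuc c ⊔ ℓ₁ ⊔ ℓ₂)
  ιR {X} {Y} A D t = Σ (Pred ∣ X ⊸ Y ∣ c) λ B → (pairR {X} {Y} A B ⊆ D) × B t

  ↓ : ∀ {X} → ∣ X ∣ → Pred ∣ X ∣ c
  ↓ {X} x x′ = x′ ⊑ x

  module _ (ω : ∣ 𝟘 ∣) where
    ⫫ : Pred ∣ 𝟘 ∣ c
    ⫫ = ↓ ω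

    wR : ∀ X {ℓ} → Pred ∣ X ∣ ℓ → Pred ∣ X ⊸ 𝟘 ∣ (lsuc c ⊔ ℓ)
    wR X A = ιR {X} {𝟘} A ⫫

    perp : ∀ X {ℓ} → Pred ∣ X ⊸ 𝟘 ∣ ℓ → Pred ∣ X ∣ (lsuc c ⊔ ℓ)
    perp X B x = Σ (Pred ∣ X ∣ c) λ A → (pairR {X} {𝟘} A B ⊆ ⫫) × A x

    jR : ∀ X {ℓ} → Pred ∣ X ∣ ℓ → Pred ∣ X ∣ (lsuc c ⊔ ℓ)
    jR X A = perp X (wR X A)

    InRȷ : ∀ X → Pred ∣ X ∣ c → Set (lsuc c)
    InRȷ X A = jR X A ≐ A

    Rȷ₁ : ∀ {X Y} → Hom X Y → Pred ∣ X ∣ c → Pred ∣ Y ∣ (lsuc c)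
    Rȷ₁ {X} {Y} f A = jR Y (R₁ f A)

    ⋁Rȷ : ∀ X {ℓ} → Pred (Pred ∣ X ∣ c) ℓ → Pred ∣ X ∣ (lsuc c ⊔ ℓ)
    ⋁Rȷ X 𝒮 = jR X (λ x → Σ (Pred ∣ X ∣ c) λ A → 𝒮 A × A x)

    record DownNatIso : Set (o ⊔ h ⊔ lsuc c) where
      field
        well-defined : ∀ X (x : ∣ X ∣) → InRȷ X (↓ x)
        sup-preserving : ∀ X (S : Pred ∣ X ∣ c) →
          ↓ (SLatt.⋁ (F₀ X) S) ≐ ⋁Rȷ X (image (↓ {X}) S)
        injective : ∀ X (x y : ∣ X ∣) → ↓ x ≐ ↓ y → x ≡ y
        surjective : ∀ X (A : Pred ∣ X ∣ c) → InRȷ X A → Σ ∣ X ∣ λ x → ↓ x ≐ A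
        natural : ∀ {X Y} (f : Hom X Y) (x : ∣ X ∣) → Rȷ₁ f (↓ x) ≐ ↓ (F₁ f x)

-- Call x ∈ Q(X) and b ∈ Q(X*) orthogonal, x ⊥ b, when ⟨x,b⟩ ≤ ω.  Since R(X) consists of subsets
-- of Q(X) and ⫫ = ↓ω, the pairing of R lands in ⫫ exactly when its arguments are elementwise
-- orthogonal, so ȷ_X(A) is the biorthogonal closure of A with respect to ⊥.  Dualizing of (0,ω)
-- in ∫Q says that x′ ⊥ ω_X(x) forces x′ ≤ x, i.e. ⊥ separates the points of Q(X); hence the
-- biorthogonal closure of A is ↓(⋁A), and ↓ is a sup-preserving natural bijection onto R^ȷ(X).
module Submission where

open import Defs
open import Data.Product using (Σ; _,_; proj₂)
open import Data.Sum using (_⊎_; inj₁; inj₂)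
open import Function using (id)
open import Relation.Binary.PropositionalEquality
open import Relation.Unary using (Pred; _⊆_; _≐_)

module SupPreservingProperties {c} {L M : SLatt c} {f : SLatt.Carrier L → SLatt.Carrier M}
                               (f-sup : SupPreserving L M f) where
  private
    module L = SLatt L
    module M = SLatt M

  ⋁-least : ∀ (S : Pred L.Carrier c) {m} → (∀ {a} → S a → f a M.≤ m) → f (L.⋁ S) M.≤ m
  ⋁-least S {m} h =
    subst (M._≤ m) (sym (f-sup S)) (M.⋁-least (image f S) λ { (a , Sa , refl) → h Sa })

  monotone : ∀ {x y} → x L.≤ y → f x M.≤ f y
  monotone {x} {y} x≤y = subst (f x M.≤_) f⋁≡fy (M.⋁-upper (image f x∪y) (x , inj₁ refl , refl))
    where
    x∪y : Pred L.Carrier c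
    x∪y z = z ≡ x ⊎ z ≡ y
    ⋁x∪y≡y : L.⋁ x∪y ≡ y
    ⋁x∪y≡y = L.≤-antisym (L.⋁-least x∪y λ { (inj₁ refl) → x≤y ; (inj₂ refl) → L.≤-refl })
                          (L.⋁-upper x∪y (inj₂ refl))
    f⋁≡fy : M.⋁ (image f x∪y) ≡ f y
    f⋁≡fy = trans (sym (f-sup x∪y)) (cong f ⋁x∪y≡y)

module Pairing {o h c} (C : StarAutonomous o h) (Q : MonoidalFunctor (StarAutonomous.smc C) c) where
  open StarAutonomous C
  open SMCCat smc renaming (id to idC)
  open MonoidalFunctor Q
  open Constructions C Q

  module L X = SLatt (F₀ X)
  module F₁ {X Y} (f : Hom X Y) = SupPreservingProperties {L = F₀ X} {F₀ Y} {F₁ f} (F₁-sup f)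

  pairQ-monoˡ : ∀ {X Y} {x x′ : ∣ X ∣} {b} → x′ ⊑ x → pairQ {X} {Y} x′ b ⊑ pairQ x b
  pairQ-monoˡ {X} {Y} {b = b} x′≤x = F₁.monotone ev (μ-b.monotone x′≤x)
    where
    module μ-b = SupPreservingProperties {L = F₀ X} {F₀ (X ⊗₀ (X ⊸ Y))} {λ a → μ a b}
                                         (μ-supˡ b)

  pairQ-⋁ˡ-least : ∀ {X Y} (A : Pred ∣ X ∣ c) {b} {y : ∣ Y ∣} →
                   (∀ {a} → A a → pairQ a b ⊑ y) → pairQ (L.⋁ X A) b ⊑ y
  pairQ-⋁ˡ-least A {b} {y} h =
    subst (λ z → F₁ ev z ⊑ y) (sym (μ-supˡ b A))
      (F₁.⋁-least ev (image (λ a → μ a b) A) λ { (a , Aa , refl) → h Aa })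

  pairQ-⋁ʳ-least : ∀ {X Y} {x : ∣ X ∣} (B : Pred ∣ X ⊸ Y ∣ c) {y : ∣ Y ∣} →
                   (∀ {b} → B b → pairQ x b ⊑ y) → pairQ x (L.⋁ (X ⊸ Y) B) ⊑ y
  pairQ-⋁ʳ-least {x = x} B {y} h =
    subst (λ z → F₁ ev z ⊑ y) (sym (μ-supʳ x B))
      (F₁.⋁-least ev (image (μ x) B) λ { (b , Bb , refl) → h Bb })

  pairQ-ιQ : ∀ {X Y} (x : ∣ X ∣) (y : ∣ Y ∣) → pairQ x (ιQ x y) ⊑ y
  pairQ-ιQ x y = pairQ-⋁ʳ-least (λ b → pairQ x b ⊑ y) id

  pairQ-canonJ : ∀ {X Z} (x : ∣ X ∣) (b : ∣ X ⊸ Z ∣) →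
                 pairQ b (F₁ (canonJ smc Z X) x) ≡ pairQ x b
  pairQ-canonJ {X} {Z} x b = begin
    F₁ ev (μ b (F₁ j x))           ≡⟨ cong (λ z → F₁ ev (μ z (F₁ j x))) (sym (F-id b)) ⟩
    F₁ ev (μ (F₁ idC b) (F₁ j x))  ≡⟨ cong (F₁ ev) (sym (μ-nat _ j b x)) ⟩
    F₁ ev (F₁ (idC ⊗₁ j) (μ b x))  ≡⟨ sym (F-∘ ev _ _) ⟩
    F₁ (ev ∘ (idC ⊗₁ j)) (μ b x)   ≡⟨ cong (λ g → F₁ g (μ b x)) (Λ-β _) ⟩
    F₁ (ev ∘ σ) (μ b x)            ≡⟨ F-∘ ev σ _ ⟩
    F₁ ev (F₁ σ (μ b x))           ≡⟨ cong (F₁ ev) (μ-sym b x) ⟩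
    F₁ ev (μ x b)                  ∎
    where
    open ≡-Reasoning
    j = canonJ smc Z X

module Orthogonality {o h c} (C : StarAutonomous o h) (Q : MonoidalFunctor (StarAutonomous.smc C) c)
                     (ω : MonoidalFunctor.∣_∣ Q (StarAutonomous.𝟘 C)) where
  open StarAutonomous C
  open SMCCat smc hiding (id)
  open MonoidalFunctor Q
  open Constructions C Q
  open Pairing C Q

  infix 4 _⊥_
  _⊥_ : ∀ {X} → ∣ X ∣ → ∣ X ⊸ 𝟘 ∣ → Set c
  x ⊥ b = pairQ x b ⊑ ω

  ⊥-monoˡ : ∀ {X} {x x′ : ∣ X ∣} {b} → x′ ⊑ x → x ⊥ b → x′ ⊥ b
  ⊥-monoˡ x′≤x x⊥b = L.≤-trans _ (pairQ-monoˡ x′≤x) x⊥b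

  module _ {X} {ℓ₁ ℓ₂} {A : Pred ∣ X ∣ ℓ₁} {B : Pred ∣ X ⊸ 𝟘 ∣ ℓ₂} where

    pairR⊆⫫⇒⊥ : pairR A B ⊆ ⫫ ω → ∀ {a b} → A a → B b → a ⊥ b
    pairR⊆⫫⇒⊥ AB⊆⫫ Aa Bb = AB⊆⫫ (_ , (_ , _ , Aa , Bb , refl) , refl)

    ⊥⇒pairR⊆⫫ : (∀ {a b} → A a → B b → a ⊥ b) → pairR A B ⊆ ⫫ ω
    ⊥⇒pairR⊆⫫ A⊥B (_ , (a , b , Aa , Bb , refl) , refl) = A⊥B Aa Bb

  module _ {X} {ℓ} {A : Pred ∣ X ∣ ℓ} where

    wR-elim : ∀ {b} → wR ω X A b → ∀ {a} → A a → a ⊥ b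
    wR-elim (B , AB⊆⫫ , Bb) Aa = pairR⊆⫫⇒⊥ AB⊆⫫ Aa Bb

    wR-intro : ∀ {b} → (∀ {a} → A a → a ⊥ b) → wR ω X A b
    wR-intro {b} A⊥b = (_≡ b) , ⊥⇒pairR⊆⫫ (λ { Aa refl → A⊥b Aa }) , refl

  module _ {X} {ℓ} {B : Pred ∣ X ⊸ 𝟘 ∣ ℓ} where

    perp-elim : ∀ {x} → perp ω X B x → ∀ {b} → B b → x ⊥ b
    perp-elim (A , AB⊆⫫ , Ax) Bb = pairR⊆⫫⇒⊥ AB⊆⫫ Ax Bb

    perp-intro : ∀ {x} → (∀ {b} → B b → x ⊥ b) → perp ω X B x
    perp-intro {x} x⊥B = (_≡ x) , ⊥⇒pairR⊆⫫ (λ { refl Bb → x⊥B Bb }) , refl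

  module _ {X} {ℓ} {A : Pred ∣ X ∣ ℓ} where

    jR-elim : ∀ {x} → jR ω X A x → ∀ {b} → (∀ {a} → A a → a ⊥ b) → x ⊥ b
    jR-elim jAx A⊥b = perp-elim jAx (wR-intro A⊥b)

    jR-intro : ∀ {x} → (∀ {b} → (∀ {a} → A a → a ⊥ b) → x ⊥ b) → jR ω X A x
    jR-intro x⊥A⊥ = perp-intro (λ wAb → x⊥A⊥ (wR-elim wAb))

    jR-extensive : A ⊆ jR ω X A
    jR-extensive Ax = jR-intro (λ A⊥b → A⊥b Ax)

    ↓⊆jR : ∀ {y} → A y → ↓ y ⊆ jR ω X A
    ↓⊆jR Ay x≤y = jR-intro (λ A⊥b → ⊥-monoˡ x≤y (A⊥b Ay))

    ↓⋁⊆jR : ∀ {S : Pred ∣ X ∣ c} → S ⊆ A → ↓ (L.⋁ X S) ⊆ jR ω X A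
    ↓⋁⊆jR {S} S⊆A x≤⋁S =
      jR-intro (λ A⊥b → ⊥-monoˡ x≤⋁S (pairQ-⋁ˡ-least S (λ Ss → A⊥b (S⊆A Ss))))

  module _ (dualizing : IsDualizing∫ ω) where

    ⊥-neg⇒⊑ : ∀ {X} {x x′ : ∣ X ∣} → x′ ⊥ negQ ω X x → x′ ⊑ x
    ⊥-neg⇒⊑ {X} {x} {x′} x′⊥nx =
      subst (_⊑ x) jinv-j (L.≤-trans X (F₁.monotone (jinv X) jx′≤nnx) (proj₂ (dualizing X x)))
      where
      j = canonJ smc 𝟘 X
      jx′≤nnx : F₁ j x′ ⊑ negQ ω (X ⊸ 𝟘) (negQ ω X x)
      jx′≤nnx = L.⋁-upper _ _ (subst (_⊑ ω) (sym (pairQ-canonJ x′ (negQ ω X x))) x′⊥nx)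
      jinv-j : F₁ (jinv X) (F₁ j x′) ≡ x′
      jinv-j = trans (sym (F-∘ (jinv X) j x′)) (trans (cong (λ g → F₁ g x′) (jinvˡ X)) (F-id x′))

    ⊥-separates : ∀ {X} {x x′ : ∣ X ∣} → (∀ {b} → x ⊥ b → x′ ⊥ b) → x′ ⊑ x
    ⊥-separates {x = x} x⊥⇒x′⊥ = ⊥-neg⇒⊑ (x⊥⇒x′⊥ (pairQ-ιQ x ω))

    jR-⊆↓ : ∀ {X ℓ} {A : Pred ∣ X ∣ ℓ} {x : ∣ X ∣} → A ⊆ ↓ x → jR ω X A ⊆ ↓ x
    jR-⊆↓ A⊆↓x jAx′ = ⊥-separates (λ x⊥b → jR-elim jAx′ (λ Aa → ⊥-monoˡ (A⊆↓x Aa) x⊥b))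

    ↓-InRȷ : ∀ X (x : ∣ X ∣) → InRȷ ω X (↓ x)
    ↓-InRȷ X x = jR-⊆↓ id , jR-extensive

    ↓-⋁ : ∀ X (S : Pred ∣ X ∣ c) → ↓ (L.⋁ X S) ≐ ⋁Rȷ ω X (image (↓ {X}) S)
    ↓-⋁ X S =
      ↓⋁⊆jR (λ {s} Ss → ↓ s , (s , Ss , refl) , L.≤-refl X) ,
      jR-⊆↓ (λ { (_ , (s , Ss , refl) , a≤s) → L.≤-trans X a≤s (L.⋁-upper X S Ss) })

    ↓-injective : ∀ X (x y : ∣ X ∣) → ↓ x ≐ ↓ y → x ≡ y
    ↓-injective X x y (↓x⊆↓y , ↓y⊆↓x) = L.≤-antisym X (↓x⊆↓y (L.≤-refl X)) (↓y⊆↓x (L.≤-refl X))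

    ↓-surjective : ∀ X (A : Pred ∣ X ∣ c) → InRȷ ω X A → Σ ∣ X ∣ λ x → ↓ x ≐ A
    ↓-surjective X A (jA⊆A , _) = L.⋁ X A , (λ x≤⋁A → jA⊆A (↓⋁⊆jR id x≤⋁A)) , L.⋁-upper X A

    ↓-natural : ∀ {X Y} (f : Hom X Y) (x : ∣ X ∣) → Rȷ₁ ω f (↓ x) ≐ ↓ (F₁ f x)
    ↓-natural {X} f x =
      jR-⊆↓ (λ { (x′ , x′≤x , refl) → F₁.monotone f x′≤x }) ,
      ↓⊆jR (x , L.≤-refl X , refl)

mainTheorem16 : ∀ {o h c} (C : StarAutonomous o h)
    (Q : MonoidalFunctor (StarAutonomous.smc C) c)
    (ω : MonoidalFunctor.∣_∣ Q (StarAutonomous.𝟘 C)) →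
    Constructions.IsDualizing∫ C Q ω →
    Constructions.DownNatIso C Q ω
mainTheorem16 C Q ω dualizing = record
  { well-defined   = ↓-InRȷ dualizing
  ; sup-preserving = ↓-⋁ dualizing
  ; injective      = ↓-injective dualizing
  ; surjective     = ↓-surjective dualizing
  ; natural        = ↓-natural dualizing
  }
  where open Orthogonality C Q ω
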